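{- Let $t\ge 1$ and $s\ge 2$ be integers. Then $\chi_p(P_{3t}\Diamond_3 C_{4s+1})\le 4$ if $1\le t\le 2$, and $\chi_p(P_{3t}\Diamond_3 C_{4s+1})\le 5$ if $t\ge 3$. Moreover, equality holds for $t\in\{1,2\}$.
   Context: A packing $k$-coloring of a graph $H$ is a map $c:V(H)\to\{1,\ldots,k\}$ such that any two distinct vertices $u,v$ with $c(u)=c(v)=i$ satisfy $d_H(u,v)\ge i+1$. The packing chromatic number $\chi_p(H)$ is the least such $k$. $P_m$ denotes the path $v_1\cdots v_m$ and $C_n$ the cycle on $n$ vertices. Path-aligned product: for positive integers $\ell\mid m$ and a connected vertex-transitive graph $G$ containing $P_\ell$ as a subgraph, $P_m\Diamond_\ell G$ is formed from the path $P_m=v_1\cdots v_m$ and $m/\ell$ pairwise disjoint copies of $G$, where for each $1\le i\le m/\ell$ the consecutive path vertices $v_{(i-1)\ell+1},\ldots,v_{i\ell}$ are identified, in order, with the vertices of a path $P_\ell$ (i.e. $\ell$ consecutive cycle vertices when $G$ is a cycle) in the $i$-th copy of $G$. -}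

module Defs where

open import Level using (0ℓ)
open import Data.Nat using (ℕ; zero; suc; _+_; _*_; _≤_; _<_; _%_; NonZero)
open import Data.Nat.DivMod using (m%n<n)
open import Data.Fin using (fromℕ<)
open import Data.Fin using (Fin; toℕ; fromℕ; zero)
open import Data.Product using (_×_; _,_; ∃-syntax)
open import Data.Sum using (_⊎_)
open import Relation.Nullary using (¬_)
open import Relation.Binary.PropositionalEquality using (_≡_; _≢_)

record Graph : Set₁ where
  field
    V   : Set
    Adj : V → V → Set
open Graph public

data Walk (G : Graph) : V G → V G → ℕ → Set where
  here : ∀ {u} → Walk G u u 0
  step : ∀ {u w v n} → Adj G u w → Walk G w v n → Walk G u v (suc n)

-- d_G(u,v) ≥ d : there is no walk (hence no path) of length < d from u to v.
DistAtLeast : (G : Graph) → V G → V G → ℕ → Set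
DistAtLeast G u v d = ∀ n → n < d → ¬ Walk G u v n

record PackingColoring (G : Graph) (k : ℕ) : Set where
  field
    col      : V G → ℕ
    col-pos  : ∀ v → 1 ≤ col v
    col-le   : ∀ v → col v ≤ k
    packing  : ∀ u v → u ≢ v → col u ≡ col v → DistAtLeast G u v (suc (col u))

χp≤ : Graph → ℕ → Set
χp≤ G k = PackingColoring G k

χp≡ : Graph → ℕ → Set
χp≡ G k = PackingColoring G k × (∀ j → j < k → ¬ PackingColoring G j)

Cycle : (n : ℕ) → .{{NonZero n}} → Graph
Cycle n = record
  { V   = Fin n
  ; Adj = λ a b → (toℕ b ≡ suc (toℕ a) % n) ⊎ (toℕ a ≡ suc (toℕ b) % n)
  }

-- Path-aligned product P_m ◇_ℓ G with ℓ = suc ℓ' and m = ℓ * q.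
-- p : Fin ℓ → V G is the copy of P_ℓ in G (p 0, …, p (ℓ-1)) with which the
-- path vertices v_{(i-1)ℓ+1},…,v_{iℓ} are identified in the i-th copy of G.
-- Vertices: (i , x) = vertex x of the i-th copy of G (i ∈ {0,…,q-1}).
-- Edges: edges of each copy of G (these contain the path edges inside a
-- block), plus the path edge v_{iℓ} v_{iℓ+1} joining p(ℓ-1) of copy i to
-- p(0) of copy i+1.
PathAligned : (q ℓ' : ℕ) (G : Graph) → (Fin (suc ℓ') → V G) → Graph
PathAligned q ℓ' G p = record
  { V   = Fin q × V G
  ; Adj = λ { (i , x) (j , y) →
              (i ≡ j × Adj G x y)
            ⊎ (toℕ j ≡ suc (toℕ i) × x ≡ p (fromℕ ℓ') × y ≡ p zero)
            ⊎ (toℕ i ≡ suc (toℕ j) × y ≡ p (fromℕ ℓ') × x ≡ p zero) }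
  }

-- P_{3t} ◇_3 C_{4s+1}: the path P_3 in C_{4s+1} is 0,1,2 (consecutive
-- cycle vertices); j ↦ j mod (4s+1), which is j itself whenever s ≥ 1.
cycleVertex : (n : ℕ) → .{{NonZero n}} → Fin 3 → Fin n
cycleVertex n j = fromℕ< (m%n<n (toℕ j) n)

P◇C : (t s : ℕ) → Graph
P◇C t s = PathAligned t 2 (Cycle (1 + 4 * s)) (cycleVertex (1 + 4 * s))

{-# OPTIONS --safe #-}
module Submission where

-- Vertex j of C_{4s+1} gets a state: its own position if j ≤ 6, otherwise
-- j mod 4. The colour of a vertex depends only on its copy and its state. A walk inside a
-- copy between distinct vertices x, y yields a k-step arc from one to the other with k no
-- longer than the walk, and the states of the arc form a k-step path of the finite state
-- automaton; so the packing condition inside a copy is a finite check. A walk from copy I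
-- to copy J > I runs through every bridge in between, so its length is at least
-- d(x,2) + 1 + 3(J-I-1) + d(0,y), and both distances are bounded below by 1-Lipschitz
-- functions of the state. Consecutive copies alternate between two colourings that differ
-- only at vertex 2 (colours 4 and 5); for t ≤ 2 a second colouring with colours ≤ 4 serves
-- copy 1.
--
-- In a packing 3-colouring of a cycle no two adjacent vertices have colour 1,
-- and a short case analysis shows that one of any two adjacent vertices does; so colour 1
-- alternates around the cycle, which is impossible since the first copy is the odd cycle
-- C_{4s+1}.

open import Defs
open import Data.Nat using (ℕ; _≤_)
open import Data.Product using (_×_)
open import Data.Bool using (not)
open import Data.Bool.Properties using (not-involutive; not-¬)
open import Data.Empty using (⊥; ⊥-elim)
open import Data.Fin using (Fin; toℕ; fromℕ; fromℕ<; zero)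
open import Data.Fin.Properties using (toℕ-injective; toℕ-fromℕ<; toℕ<n)
open import Data.List using (List; []; _∷_)
open import Data.List.Membership.Propositional using (_∈_)
open import Data.List.Relation.Unary.All using (All; []; _∷_; all?; lookup; tabulate)
open import Data.List.Relation.Unary.Any using (here; there)
open import Data.Nat
  using (zero; suc; _+_; _*_; _<_; _%_; _/_; _≡ᵇ_; z≤n; s≤s; s≤s⁻¹; NonZero; _≤?_; _≟_)
open import Data.Nat.DivMod
  using (m%n<n; m<n⇒m%n≡m; [m+n]%n≡m%n; m≡m%n+[m/n]*n; %-distribˡ-+; m%n%n≡m%n; n%n≡0)
open import Data.Nat.Divisibility using (_∣_; divides; ∣⇒≤; ∣-trans; m∣m*n)
open import Data.Nat.GeneralisedArithmetic using (fold; fold-+)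
open import Data.Nat.Properties
open import Data.Product using (_,_; proj₁; proj₂; ∃-syntax)
open import Data.Sum using (_⊎_; inj₁; inj₂; swap)
open import Function using (_∘_; Injective)
open import Relation.Binary.Definitions using (tri<; tri≈; tri>)
open import Relation.Binary.PropositionalEquality
open import Relation.Nullary using (¬_; Dec)
open import Relation.Nullary.Decidable
  using (True; toWitness; from-yes; map′; ¬?; _→-dec_; _×-dec_)
open import Relation.Unary using (Decidable)
open ≡-Reasoning

private variable
  G H : Graph
  k m : ℕ

Undirected : Graph → Set
Undirected G = ∀ {u v} → Adj G u v → Adj G v u

snoc : ∀ {u v w} → Walk G u v m → Adj G v w → Walk G u w (suc m)
snoc here       b = step b here
snoc (step a w) b = step a (snoc w b)

reverse : Undirected G → ∀ {u v} → Walk G u v m → Walk G v u m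
reverse sym here       = here
reverse sym (step a w) = snoc (reverse sym w) (sym a)

Contraction : (G H : Graph) → (V G → V H) → Set
Contraction G H f = ∀ {u v} → Adj G u v → f u ≡ f v ⊎ Adj H (f u) (f v)

contract-walk : ∀ {f} → Contraction G H f →
                ∀ {u v} → Walk G u v m → ∃[ m′ ] m′ ≤ m × Walk H (f u) (f v) m′
contract-walk c here = 0 , z≤n , here
contract-walk {H = H} {f = f} c {v = v} (step a w) with contract-walk c w | c a
... | m′ , m′≤m , w′ | inj₁ eq = m′ , m≤n⇒m≤1+n m′≤m , subst (λ x → Walk H x (f v) m′) (sym eq) w′
... | m′ , m′≤m , w′ | inj₂ b  = suc m′ , s≤s m′≤m , step b w′

Lipschitz : (G : Graph) → (V G → ℕ) → Set
Lipschitz G f = ∀ {u v} → Adj G u v → f u ≤ suc (f v)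

walk-lipschitz : ∀ {f} → Lipschitz G f → ∀ {u v} → Walk G u v m → f u ≤ m + f v
walk-lipschitz lip here       = ≤-refl
walk-lipschitz lip (step a w) = ≤-trans (lip a) (s≤s (walk-lipschitz lip w))

packing-mono : k ≤ m → PackingColoring G k → PackingColoring G m
packing-mono k≤m c = record
  { col = col ; col-pos = col-pos ; col-le = λ v → ≤-trans (col-le v) k≤m ; packing = packing }
  where open PackingColoring c

packing-restrict : (f : V H → V G) → Injective _≡_ _≡_ f →
                   (∀ {a b} → Adj H a b → Adj G (f a) (f b)) →
                   PackingColoring G k → PackingColoring H k
packing-restrict {H = H} f f-inj hom c = record
  { col = col ∘ f ; col-pos = col-pos ∘ f ; col-le = col-le ∘ f ; packing = packing′ }
  where
  open PackingColoring c
  packing′ : ∀ u v → u ≢ v → col (f u) ≡ col (f v) → DistAtLeast H u v (suc (col (f u)))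
  packing′ u v u≢v eq m m≤c w with contract-walk {f = f} (inj₂ ∘ hom) w
  ... | m′ , m′≤m , w′ = packing (f u) (f v) (u≢v ∘ f-inj) eq m′ (≤-<-trans m′≤m m≤c) w′

[m+d]%n≡m⇒n∣d : ∀ {m d n} .{{_ : NonZero n}} → (m + d) % n ≡ m → n ∣ d
[m+d]%n≡m⇒n∣d {m} {d} {n} eq = divides ((m + d) / n) (+-cancelˡ-≡ m _ _ (begin
  m + d                          ≡⟨ m≡m%n+[m/n]*n (m + d) n ⟩
  (m + d) % n + (m + d) / n * n  ≡⟨ cong (_+ (m + d) / n * n) eq ⟩
  m + (m + d) / n * n            ∎))

suc[m%n]%n≡suc[m]%n : ∀ m n .{{_ : NonZero n}} → suc (m % n) % n ≡ suc m % n
suc[m%n]%n≡suc[m]%n m n = begin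
  (1 + m % n) % n          ≡⟨ %-distribˡ-+ 1 (m % n) n ⟩
  (1 % n + m % n % n) % n  ≡⟨ cong (λ r → (1 % n + r) % n) (m%n%n≡m%n m n) ⟩
  (1 % n + m % n) % n      ≡⟨ %-distribˡ-+ 1 m n ⟨
  (1 + m) % n              ∎

module Rotation (n : ℕ) where

  C : Graph
  C = Cycle (suc n)

  next : Fin (suc n) → Fin (suc n)
  next x = fromℕ< (m%n<n (suc (toℕ x)) (suc n))

  infixl 6 _⊕_
  _⊕_ : Fin (suc n) → ℕ → Fin (suc n)
  x ⊕ k = fold x next k

  toℕ-next : ∀ x → toℕ (next x) ≡ suc (toℕ x) % suc n
  toℕ-next x = toℕ-fromℕ< (m%n<n (suc (toℕ x)) (suc n))

  adj-next : ∀ x → Adj C x (next x)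
  adj-next x = inj₁ (toℕ-next x)

  adj⇒next : ∀ {x y} → Adj C x y → y ≡ next x ⊎ x ≡ next y
  adj⇒next (inj₁ e) = inj₁ (toℕ-injective (trans e (sym (toℕ-next _))))
  adj⇒next (inj₂ e) = inj₂ (toℕ-injective (trans e (sym (toℕ-next _))))

  C-undirected : Undirected C
  C-undirected = swap

  walk-⊕ : ∀ x k → Walk C x (x ⊕ k) k
  walk-⊕ x zero    = here
  walk-⊕ x (suc k) = snoc (walk-⊕ x k) (adj-next (x ⊕ k))

  next-⊕ : ∀ x k → next x ⊕ k ≡ next (x ⊕ k)
  next-⊕ x zero    = refl
  next-⊕ x (suc k) = cong next (next-⊕ x k)

  toℕ-⊕ : ∀ x k → toℕ (x ⊕ k) ≡ (toℕ x + k) % suc n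
  toℕ-⊕ x zero = sym (trans (cong (_% suc n) (+-identityʳ (toℕ x))) (m<n⇒m%n≡m (toℕ<n x)))
  toℕ-⊕ x (suc k) = begin
    toℕ (next (x ⊕ k))                 ≡⟨ toℕ-next (x ⊕ k) ⟩
    suc (toℕ (x ⊕ k)) % suc n          ≡⟨ cong (λ r → suc r % suc n) (toℕ-⊕ x k) ⟩
    suc ((toℕ x + k) % suc n) % suc n  ≡⟨ suc[m%n]%n≡suc[m]%n (toℕ x + k) (suc n) ⟩
    suc (toℕ x + k) % suc n            ≡⟨ cong (_% suc n) (+-suc (toℕ x) k) ⟨
    (toℕ x + suc k) % suc n            ∎

  ⊕-period : ∀ x → x ⊕ suc n ≡ x
  ⊕-period x = toℕ-injective (begin
    toℕ (x ⊕ suc n)          ≡⟨ toℕ-⊕ x (suc n) ⟩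
    (toℕ x + suc n) % suc n  ≡⟨ [m+n]%n≡m%n (toℕ x) (suc n) ⟩
    toℕ x % suc n            ≡⟨ m<n⇒m%n≡m (toℕ<n x) ⟩
    toℕ x                    ∎)

  ⊕-≢ : ∀ x {d} → 0 < d → d < suc n → x ⊕ d ≢ x
  ⊕-≢ x {suc d} _ d<N eq =
    <⇒≱ d<N (∣⇒≤ ([m+d]%n≡m⇒n∣d (trans (sym (toℕ-⊕ x (suc d))) (cong toℕ eq))))

  next-injective : ∀ {x y} → next x ≡ next y → x ≡ y
  next-injective {x} {y} e = begin
    x           ≡⟨ ⊕-period x ⟨
    x ⊕ suc n   ≡⟨ next-⊕ x n ⟨
    next x ⊕ n  ≡⟨ cong (_⊕ n) e ⟩
    next y ⊕ n  ≡⟨ next-⊕ y n ⟩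
    y ⊕ suc n   ≡⟨ ⊕-period y ⟩
    y           ∎

  Arc≤ : Fin (suc n) → Fin (suc n) → ℕ → Set
  Arc≤ x y m = ∃[ k ] k ≤ m × (y ≡ x ⊕ k ⊎ x ≡ y ⊕ k)

  arc-step : ∀ {x w y m} → Adj C x w → Arc≤ w y m → Arc≤ x y (suc m)
  arc-step {x} a (k , k≤m , arc) with adj⇒next a | arc
  arc-step {x} a (k     , k≤m , _) | inj₁ refl | inj₁ refl = suc k , s≤s k≤m , inj₁ (next-⊕ x k)
  arc-step     a (zero  , _   , _) | inj₁ refl | inj₂ e    = 1 , s≤s z≤n , inj₁ (sym e)
  arc-step     a (suc j , j<m , _) | inj₁ refl | inj₂ e    =
    j , m≤n⇒m≤1+n (<⇒≤ j<m) , inj₂ (next-injective e)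
  arc-step     a (zero  , _   , _) | inj₂ refl | inj₁ e    = 1 , s≤s z≤n , inj₂ (cong next (sym e))
  arc-step     a (suc j , j<m , _) | inj₂ refl | inj₁ e    =
    j , m≤n⇒m≤1+n (<⇒≤ j<m) , inj₁ (trans e (sym (next-⊕ _ j)))
  arc-step     a (k     , k≤m , _) | inj₂ refl | inj₂ e    = suc k , s≤s k≤m , inj₂ (cong next e)

  walk⇒arc : ∀ {x y} → Walk C x y m → Arc≤ x y m
  walk⇒arc here       = 0 , z≤n , inj₁ refl
  walk⇒arc (step a w) = arc-step a (walk⇒arc w)

RayPacking : (ℕ → ℕ) → Set
RayPacking a = ∀ i d → 0 < d → d ≤ a i → a (d + i) ≢ a i

module _ {a : ℕ → ℕ} (a-pos : ∀ i → 1 ≤ a i) (a≤3 : ∀ i → a i ≤ 3) (ray : RayPacking a) where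

  private
    colour-cases : ∀ i → a i ≡ 1 ⊎ a i ≡ 2 ⊎ a i ≡ 3
    colour-cases i with a i | a-pos i | a≤3 i
    ... | 1 | _ | _ = inj₁ refl
    ... | 2 | _ | _ = inj₂ (inj₁ refl)
    ... | 3 | _ | _ = inj₂ (inj₂ refl)
    ... | suc (suc (suc (suc _))) | _ | s≤s (s≤s (s≤s ()))

    clash : ∀ j d {c} {_ : True (1 ≤? d)} {_ : True (d ≤? c)} → a j ≡ c → a (d + j) ≡ c → ⊥
    clash j d {_} {0<d} {d≤c} p q =
      ray j d (toWitness 0<d) (subst (d ≤_) (sym p) (toWitness d≤c)) (trans q (sym p))

    no-3-2 : ∀ i → a (2 + i) ≡ 3 → a (3 + i) ≡ 2 → ⊥
    no-3-2 i p q with colour-cases (4 + i)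
    ... | inj₂ (inj₁ r) = clash (3 + i) 1 q r
    ... | inj₂ (inj₂ r) = clash (2 + i) 2 p r
    ... | inj₁ r with colour-cases (5 + i)
    ...   | inj₁ r′        = clash (4 + i) 1 r r′
    ...   | inj₂ (inj₁ r′) = clash (3 + i) 2 q r′
    ...   | inj₂ (inj₂ r′) = clash (2 + i) 3 p r′

    no-2-3 : ∀ i → a (2 + i) ≡ 2 → a (3 + i) ≡ 3 → ⊥
    no-2-3 i p q with colour-cases (1 + i)
    ... | inj₂ (inj₁ r) = clash (1 + i) 1 r p
    ... | inj₂ (inj₂ r) = clash (1 + i) 2 r q
    ... | inj₁ r with colour-cases i
    ...   | inj₁ r′        = clash i 1 r′ r
    ...   | inj₂ (inj₁ r′) = clash i 2 r′ p
    ...   | inj₂ (inj₂ r′) = clash i 3 r′ q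

  ones-alternate : ∀ i → (a (3 + i) ≡ᵇ 1) ≡ not (a (2 + i) ≡ᵇ 1)
  ones-alternate i with colour-cases (2 + i) | colour-cases (3 + i)
  ... | inj₁ p        | inj₁ q        = ⊥-elim (clash (2 + i) 1 p q)
  ... | inj₂ (inj₁ p) | inj₂ (inj₁ q) = ⊥-elim (clash (2 + i) 1 p q)
  ... | inj₂ (inj₂ p) | inj₂ (inj₂ q) = ⊥-elim (clash (2 + i) 1 p q)
  ... | inj₂ (inj₁ p) | inj₂ (inj₂ q) = ⊥-elim (no-2-3 i p q)
  ... | inj₂ (inj₂ p) | inj₂ (inj₁ q) = ⊥-elim (no-3-2 i p q)
  ... | inj₁ p        | inj₂ (inj₁ q) rewrite p | q = refl
  ... | inj₁ p        | inj₂ (inj₂ q) rewrite p | q = refl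
  ... | inj₂ (inj₁ p) | inj₁ q        rewrite p | q = refl
  ... | inj₂ (inj₂ p) | inj₁ q        rewrite p | q = refl

  ones-at-odd-offset : ∀ q → (a (2 + suc (q * 2)) ≡ᵇ 1) ≡ not (a 2 ≡ᵇ 1)
  ones-at-odd-offset zero    = ones-alternate 0
  ones-at-odd-offset (suc q) = begin
    a (5 + q * 2) ≡ᵇ 1              ≡⟨ ones-alternate (2 + q * 2) ⟩
    not (a (4 + q * 2) ≡ᵇ 1)        ≡⟨ cong not (ones-alternate (1 + q * 2)) ⟩
    not (not (a (3 + q * 2) ≡ᵇ 1))  ≡⟨ not-involutive _ ⟩
    a (3 + q * 2) ≡ᵇ 1              ≡⟨ ones-at-odd-offset q ⟩
    not (a 2 ≡ᵇ 1)                  ∎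

  no-odd-period : ∀ q → (∀ i → a (i + suc (q * 2)) ≡ a i) → ⊥
  no-odd-period q period =
    not-¬ refl (trans (cong (_≡ᵇ 1) (sym (period 2))) (ones-at-odd-offset q))

odd-cycle-no-packing-3 : ∀ n → 3 ≤ n → 2 ∣ n → ¬ PackingColoring (Cycle (suc n)) 3
odd-cycle-no-packing-3 n 3≤n (divides q refl) c =
  no-odd-period (col-pos ∘ point) (col-le ∘ point) ray q period
  where
  open PackingColoring c
  open Rotation n

  point : ℕ → Fin (suc n)
  point i = zero ⊕ i

  point-+ : ∀ i d → point (d + i) ≡ point i ⊕ d
  point-+ i d = fold-+ zero next d

  ray : RayPacking (col ∘ point)
  ray i d 0<d d≤a eq = packing (point i) (point (d + i)) distinct (sym eq) d (s≤s d≤a)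
    (subst (λ v → Walk C (point i) v d) (sym (point-+ i d)) (walk-⊕ (point i) d))
    where
    distinct : point i ≢ point (d + i)
    distinct e = ⊕-≢ (point i) 0<d (s≤s (≤-trans d≤a (≤-trans (col-le _) 3≤n)))
                   (trans (sym (point-+ i d)) (sym e))

  period : ∀ i → col (point (i + suc n)) ≡ col (point i)
  period i = cong col (trans (fold-+ zero next i) (cong (_⊕ i) (⊕-period zero)))

-- Vertex j of C_{4s+1} has state Lj for j ≤ 6 and M(j mod 4) for j ≥ 7. The last vertex 4s
-- has state M0 and is followed by vertex 0, hence the extra transition M0 → L0.
data State : Set where
  L0 L1 L2 L3 L4 L5 L6 M0 M1 M2 M3 : State

states : List State
states = L0 ∷ L1 ∷ L2 ∷ L3 ∷ L4 ∷ L5 ∷ L6 ∷ M0 ∷ M1 ∷ M2 ∷ M3 ∷ []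

all-states : ∀ {P : State → Set} → All P states → ∀ σ → P σ
all-states (p0 ∷ p1 ∷ p2 ∷ p3 ∷ p4 ∷ p5 ∷ p6 ∷ q0 ∷ q1 ∷ q2 ∷ q3 ∷ []) = λ
  { L0 → p0 ; L1 → p1 ; L2 → p2 ; L3 → p3 ; L4 → p4 ; L5 → p5 ; L6 → p6
  ; M0 → q0 ; M1 → q1 ; M2 → q2 ; M3 → q3 }

∀-state? : ∀ {P : State → Set} → Decidable P → Dec (∀ σ → P σ)
∀-state? P? = map′ all-states (λ p → tabulate λ {σ} _ → p σ) (all? P? states)

next-state : State → State
next-state L0 = L1
next-state L1 = L2
next-state L2 = L3
next-state L3 = L4
next-state L4 = L5
next-state L5 = L6
next-state L6 = M3
next-state M0 = M1
next-state M1 = M2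
next-state M2 = M3
next-state M3 = M0

wrap-around : State → List State
wrap-around M0 = L0 ∷ []
wrap-around _  = []

successors : State → List State
successors σ = next-state σ ∷ wrap-around σ

After : ℕ → State → (State → Set) → Set
After zero    σ P = P σ
After (suc k) σ P = All (λ τ → After k τ P) (successors σ)

after? : ∀ {P : State → Set} → Decidable P → ∀ k σ → Dec (After k σ P)
after? P? zero    σ = P? σ
after? P? (suc k) σ = all? (after? P? k) (successors σ)

SelfPacking : (State → ℕ) → Set
SelfPacking c = ∀ σ {k} → k < c σ → After (suc k) σ (λ τ → c τ ≢ c σ)

self-packing? : ∀ c → Dec (SelfPacking c)
self-packing? c =
  ∀-state? λ σ → allUpTo? (λ k → after? (λ τ → ¬? (c τ ≟ c σ)) (suc k) σ) (c σ)

StateLipschitz : (State → ℕ) → Set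
StateLipschitz h = ∀ σ → All (λ τ → h σ ≤ suc (h τ) × h τ ≤ suc (h σ)) (successors σ)

state-lipschitz? : ∀ h → Dec (StateLipschitz h)
state-lipschitz? h =
  ∀-state? λ σ → all? (λ τ → (h σ ≤? suc (h τ)) ×-dec (h τ ≤? suc (h σ))) (successors σ)

-- Distances to L2 and to L0 in the state graph with its edges undirected.
dist₂ : State → ℕ
dist₂ L0 = 2
dist₂ L1 = 1
dist₂ L2 = 0
dist₂ L3 = 1
dist₂ L4 = 2
dist₂ L5 = 3
dist₂ L6 = 4
dist₂ M0 = 3
dist₂ M1 = 4
dist₂ M2 = 5
dist₂ M3 = 4

dist₀ : State → ℕ
dist₀ L0 = 0
dist₀ L1 = 1
dist₀ L2 = 2
dist₀ L3 = 3
dist₀ L4 = 4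
dist₀ L5 = 4
dist₀ L6 = 3
dist₀ M0 = 1
dist₀ M1 = 2
dist₀ M2 = 3
dist₀ M3 = 2

dist₂-lipschitz : StateLipschitz dist₂
dist₂-lipschitz = from-yes (state-lipschitz? dist₂)

dist₀-lipschitz : StateLipschitz dist₀
dist₀-lipschitz = from-yes (state-lipschitz? dist₀)

-- By cross-bound, a walk from state σ in copy i to state τ in copy i + 1 + d is longer than
-- the right-hand side.
Compatible : ℕ → (State → ℕ) → (State → ℕ) → Set
Compatible d c c′ = ∀ σ τ → c σ ≡ c′ τ → c σ ≤ dist₂ σ + (3 * d + dist₀ τ)

compatible? : ∀ d c c′ → Dec (Compatible d c c′)
compatible? d c c′ =
  ∀-state? λ σ → ∀-state? λ τ → (c σ ≟ c′ τ) →-dec (c σ ≤? dist₂ σ + (3 * d + dist₀ τ))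

compatible-far : ∀ d {c c′} → (∀ σ → c σ ≤ 6) → Compatible (2 + d) c c′
compatible-far d c≤6 σ τ _ =
  ≤-trans (c≤6 σ) (≤-trans (*-monoʳ-≤ 3 (m≤m+n 2 d))
    (≤-trans (m≤m+n (3 * (2 + d)) (dist₀ τ)) (m≤n+m _ (dist₂ σ))))

InRange : ℕ → (State → ℕ) → Set
InRange K c = ∀ σ → 1 ≤ c σ × c σ ≤ K

in-range? : ∀ K c → Dec (InRange K c)
in-range? K c = ∀-state? λ σ → (1 ≤? c σ) ×-dec (c σ ≤? K)

residue-state : ℕ → State
residue-state 0 = M0
residue-state 1 = M1
residue-state 2 = M2
residue-state 3 = M3
residue-state (suc (suc (suc (suc j)))) = residue-state j

residue-state-suc : ∀ j → residue-state (suc j) ≡ next-state (residue-state j)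
residue-state-suc 0 = refl
residue-state-suc 1 = refl
residue-state-suc 2 = refl
residue-state-suc 3 = refl
residue-state-suc (suc (suc (suc (suc j)))) = residue-state-suc j

residue-state-*4 : ∀ q → residue-state (q * 4) ≡ M0
residue-state-*4 zero    = refl
residue-state-*4 (suc q) = residue-state-*4 q

classify : ℕ → State
classify 0 = L0
classify 1 = L1
classify 2 = L2
classify 3 = L3
classify 4 = L4
classify 5 = L5
classify 6 = L6
classify j@(suc (suc (suc (suc (suc (suc (suc _))))))) = residue-state j

classify-suc : ∀ j → classify (suc j) ≡ next-state (classify j)
classify-suc 0 = refl
classify-suc 1 = refl
classify-suc 2 = refl
classify-suc 3 = refl
classify-suc 4 = refl
classify-suc 5 = refl
classify-suc 6 = refl
classify-suc j@(suc (suc (suc (suc (suc (suc (suc _))))))) = residue-state-suc j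

classify-4s : ∀ s′ → classify (4 * suc (suc s′)) ≡ M0
classify-4s s′ rewrite *-comm 4 (suc (suc s′)) = residue-state-*4 s′

module CycleStates (s′ : ℕ) where

  s : ℕ
  s = suc (suc s′)

  open Rotation (4 * s) public

  state : Fin (suc (4 * s)) → State
  state x = classify (toℕ x)

  state-next : ∀ x → state (next x) ∈ successors (state x)
  state-next x with m≤n⇒m<n∨m≡n (s≤s⁻¹ (toℕ<n x))
  ... | inj₁ x<4s = here (begin
    state (next x)                        ≡⟨ cong classify (toℕ-next x) ⟩
    classify (suc (toℕ x) % suc (4 * s))  ≡⟨ cong classify (m<n⇒m%n≡m (s≤s x<4s)) ⟩
    classify (suc (toℕ x))                ≡⟨ classify-suc (toℕ x) ⟩
    next-state (state x)                  ∎)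
  ... | inj₂ x≡4s =
    subst (λ σ → state (next x) ∈ successors σ) (sym state-x) (there (here state-next-x))
    where
    state-x : state x ≡ M0
    state-x = trans (cong classify x≡4s) (classify-4s s′)
    state-next-x : state (next x) ≡ L0
    state-next-x = cong classify (begin
      toℕ (next x)              ≡⟨ toℕ-next x ⟩
      suc (toℕ x) % suc (4 * s) ≡⟨ cong (λ r → suc r % suc (4 * s)) x≡4s ⟩
      suc (4 * s) % suc (4 * s) ≡⟨ n%n≡0 (suc (4 * s)) ⟩
      0                         ∎)

  after-⊕ : ∀ {P} k x → After k (state x) P → P (state (x ⊕ k))
  after-⊕         zero    x p = p
  after-⊕ {P = P} (suc k) x p =
    subst (P ∘ state) (next-⊕ x k) (after-⊕ k (next x) (lookup p (state-next x)))

  state-lipschitz : ∀ {h} → StateLipschitz h → Lipschitz C (h ∘ state)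
  state-lipschitz lip {a} {b} e with adj⇒next e
  ... | inj₁ refl = proj₁ (lookup (lip (state a)) (state-next a))
  ... | inj₂ refl = proj₂ (lookup (lip (state b)) (state-next b))

  self-packing-arc : ∀ {c} → SelfPacking c → ∀ x k → k < c (state x) →
                     c (state (x ⊕ suc k)) ≢ c (state x)
  self-packing-arc sp x k k<c = after-⊕ (suc k) x (sp (state x) k<c)

  cycle-packing : ∀ {c} → SelfPacking c → ∀ {x y m} → x ≢ y → Walk C x y m →
                  m ≤ c (state x) → c (state x) ≢ c (state y)
  cycle-packing sp {x} {y} x≢y w m≤c eq with walk⇒arc w
  ... | zero  , _   , inj₁ y≡x  = x≢y (sym y≡x)
  ... | zero  , _   , inj₂ x≡y  = x≢y x≡y
  ... | suc k , k<m , inj₁ refl = self-packing-arc sp x k (≤-trans k<m m≤c) (sym eq)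
  ... | suc k , k<m , inj₂ refl = self-packing-arc sp y k (subst (suc k ≤_) eq (≤-trans k<m m≤c)) eq

record Scheme (t K : ℕ) : Set where
  field
    colour       : ℕ → State → ℕ
    in-range     : ∀ i → InRange K (colour i)
    self-packing : ∀ i → SelfPacking (colour i)
    compatible   : ∀ i d → suc (i + d) < t → Compatible d (colour i) (colour (suc (i + d)))

module Product (t s′ : ℕ) where

  open CycleStates s′

  Γ : Graph
  Γ = P◇C t s

  Vertex : Set
  Vertex = Fin t × Fin (suc (4 * s))

  v₀ v₂ : Fin (suc (4 * s))
  v₀ = cycleVertex (suc (4 * s)) zero
  v₂ = cycleVertex (suc (4 * s)) (fromℕ 2)

  Γ-undirected : Undirected Γ
  Γ-undirected (inj₁ (e , a))            = inj₁ (sym e , C-undirected a)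
  Γ-undirected (inj₂ (inj₁ (e , p , q))) = inj₂ (inj₂ (e , p , q))
  Γ-undirected (inj₂ (inj₂ (e , p , q))) = inj₂ (inj₁ (e , p , q))

  -- Copies before copy i hang off its vertex 0 and copies after it off its vertex 2.
  squash : ℕ → Vertex → Fin (suc (4 * s))
  squash i (K , z) with <-cmp (toℕ K) i
  ... | tri< _ _ _ = v₀
  ... | tri≈ _ _ _ = z
  ... | tri> _ _ _ = v₂

  squash-here : ∀ {i K} z → toℕ K ≡ i → squash i (K , z) ≡ z
  squash-here {i} {K} z K≡i with <-cmp (toℕ K) i
  ... | tri< K<i _ _ = ⊥-elim (<-irrefl K≡i K<i)
  ... | tri≈ _ _ _   = refl
  ... | tri> _ _ i<K = ⊥-elim (<-irrefl (sym K≡i) i<K)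

  squash-bridge : ∀ i {K K′} → toℕ K′ ≡ suc (toℕ K) → squash i (K , v₂) ≡ squash i (K′ , v₀)
  squash-bridge i {K} {K′} e with <-cmp (toℕ K) i | <-cmp (toℕ K′) i
  ... | tri< _ _ _   | tri< _ _ _    = refl
  ... | tri< _ _ _   | tri≈ _ _ _    = refl
  ... | tri≈ _ _ _   | tri> _ _ _    = refl
  ... | tri> _ _ _   | tri> _ _ _    = refl
  ... | tri< K<i _ _ | tri> _ _ i<K′ = ⊥-elim (<⇒≱ i<K′ (≤-trans (≤-reflexive e) K<i))
  ... | tri≈ _ K≡i _ | tri< K′<i _ _ = ⊥-elim (<-irrefl K≡i (<-trans (≤-reflexive (sym e)) K′<i))
  ... | tri≈ _ K≡i _ | tri≈ _ K′≡i _ = ⊥-elim (<-irrefl (trans K≡i (sym K′≡i)) (≤-reflexive (sym e)))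
  ... | tri> _ _ i<K | tri< K′<i _ _ = ⊥-elim (<-asym K′<i (<-trans i<K (≤-reflexive (sym e))))
  ... | tri> _ _ i<K | tri≈ _ K′≡i _ = ⊥-elim (<-irrefl (sym K′≡i) (<-trans i<K (≤-reflexive (sym e))))

  squash-contraction : ∀ i → Contraction Γ C (squash i)
  squash-contraction i {K , z} {_ , z′} (inj₁ (refl , a)) with <-cmp (toℕ K) i
  ... | tri< _ _ _ = inj₁ refl
  ... | tri≈ _ _ _ = inj₂ a
  ... | tri> _ _ _ = inj₁ refl
  squash-contraction i (inj₂ (inj₁ (e , refl , refl))) = inj₁ (squash-bridge i e)
  squash-contraction i (inj₂ (inj₂ (e , refl , refl))) = inj₁ (sym (squash-bridge i e))

  copy-walk : ∀ {I J x y m} → toℕ I ≡ toℕ J → Walk Γ (I , x) (J , y) m →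
              ∃[ m′ ] m′ ≤ m × Walk C x y m′
  copy-walk {I} {J} {x} {y} I≡J w with contract-walk (squash-contraction (toℕ I)) w
  ... | m′ , m′≤m , w′ = m′ , m′≤m , subst₂ (λ a b → Walk C a b m′)
                           (squash-here {K = I} x refl) (squash-here {K = J} y (sym I≡J)) w′

  record Crossing (i : ℕ) (u v : Vertex) (m : ℕ) : Set where
    field
      exit entry : Fin t
      exit-copy  : toℕ exit ≡ i
      entry-copy : toℕ entry ≡ suc i
      m₁ m₂      : ℕ
      before     : Walk Γ u (exit , v₂) m₁
      after      : Walk Γ (entry , v₀) v m₂
      length     : m ≡ suc (m₁ + m₂)

  prepend : ∀ {i u w v m} → Adj Γ u w → Crossing i w v m → Crossing i u v (suc m)
  prepend a c = record
    { exit = exit ; entry = entry ; exit-copy = exit-copy ; entry-copy = entry-copy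
    ; m₁ = suc m₁ ; m₂ = m₂ ; before = step a before ; after = after ; length = cong suc length }
    where open Crossing c

  crossing : ∀ i {u v m} → toℕ (proj₁ u) ≤ i → i < toℕ (proj₁ v) → Walk Γ u v m → Crossing i u v m
  crossing i u≤i i<u here = ⊥-elim (<⇒≱ i<u u≤i)
  crossing i u≤i i<v (step a@(inj₁ (refl , _)) w) = prepend a (crossing i u≤i i<v w)
  crossing i u≤i i<v (step a@(inj₂ (inj₂ (e , _ , _))) w) =
    prepend a (crossing i (≤-trans (n≤1+n _) (subst (_≤ i) e u≤i)) i<v w)
  crossing i {K , _} u≤i i<v (step a@(inj₂ (inj₁ (e , refl , refl))) w) with m≤n⇒m<n∨m≡n u≤i
  ... | inj₁ u<i = prepend a (crossing i (subst (_≤ i) (sym e) u<i) i<v w)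
  ... | inj₂ refl = record
    { exit = K ; entry = _ ; exit-copy = refl ; entry-copy = e
    ; m₁ = 0 ; m₂ = _ ; before = here ; after = w ; length = refl }

  copy-lipschitz : ∀ {h} → StateLipschitz h → ∀ {I J x y m} → toℕ I ≡ toℕ J →
                   Walk Γ (I , x) (J , y) m → h (state x) ≤ m + h (state y)
  copy-lipschitz lip I≡J w with copy-walk I≡J w
  ... | m′ , m′≤m , w′ = ≤-trans (walk-lipschitz (state-lipschitz lip) w′) (+-monoˡ-≤ _ m′≤m)

  cross-bound : ∀ d {I J x y m} → toℕ J ≡ suc (toℕ I + d) → Walk Γ (I , x) (J , y) m →
                dist₂ (state x) + (3 * d + dist₀ (state y)) < m
  cross-bound d {I} {J} {x} {y} J≡ w =
    subst (_ <_) (sym length) (s≤s (+-mono-≤ to-exit (from-entry d J≡)))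
    where
    open Crossing (crossing (toℕ I) ≤-refl (subst (toℕ I <_) (sym J≡) (s≤s (m≤m+n _ d))) w)

    to-exit : dist₂ (state x) ≤ m₁
    to-exit = ≤-trans (copy-lipschitz dist₂-lipschitz (sym exit-copy) before)
                      (≤-reflexive (+-identityʳ m₁))

    from-entry : ∀ d → toℕ J ≡ suc (toℕ I + d) → 3 * d + dist₀ (state y) ≤ m₂
    from-entry zero J≡ =
      ≤-trans (copy-lipschitz dist₀-lipschitz J≡entry (reverse Γ-undirected after))
              (≤-reflexive (+-identityʳ m₂))
      where
      J≡entry : toℕ J ≡ toℕ entry
      J≡entry = trans J≡ (trans (cong suc (+-identityʳ _)) (sym entry-copy))
    from-entry (suc d) J≡ =
      subst (_≤ m₂) (cong (_+ dist₀ (state y)) (sym (*-suc 3 d))) (cross-bound d J≡entry+d after)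
      where
      J≡entry+d : toℕ J ≡ suc (toℕ entry + d)
      J≡entry+d = trans J≡ (cong suc (trans (+-suc (toℕ I) d) (cong (_+ d) (sym entry-copy))))

  scheme-packing : ∀ {K} → Scheme t K → PackingColoring Γ K
  scheme-packing S = record
    { col = col
    ; col-pos = λ (I , x) → proj₁ (in-range (toℕ I) (state x))
    ; col-le = λ (I , x) → proj₂ (in-range (toℕ I) (state x))
    ; packing = packing }
    where
    open Scheme S

    col : Vertex → ℕ
    col (I , x) = colour (toℕ I) (state x)

    same-copy : ∀ {I J x y m} → toℕ I ≡ toℕ J → (I , x) ≢ (J , y) → col (I , x) ≡ col (J , y) →
                m ≤ col (I , x) → Walk Γ (I , x) (J , y) m → ⊥
    same-copy I≡J u≢v eq m≤c w with toℕ-injective I≡J | copy-walk I≡J w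
    ... | refl | m′ , m′≤m , w′ =
      cycle-packing (self-packing _) (u≢v ∘ cong (_ ,_)) w′ (≤-trans m′≤m m≤c) eq

    across : ∀ {I J x y m} → toℕ I < toℕ J → col (I , x) ≡ col (J , y) →
             m ≤ col (I , x) → Walk Γ (I , x) (J , y) m → ⊥
    across {I} {J} {x} {y} I<J eq m≤c w with m≤n⇒∃[o]m+o≡n I<J
    ... | d , J≡ = <⇒≱ (≤-<-trans bound (cross-bound d (sym J≡) w)) m≤c
      where
      bound : col (I , x) ≤ dist₂ (state x) + (3 * d + dist₀ (state y))
      bound = compatible (toℕ I) d (subst (_< t) (sym J≡) (toℕ<n J)) (state x) (state y)
                (trans eq (cong (λ j → colour j (state y)) (sym J≡)))

    packing : ∀ u v → u ≢ v → col u ≡ col v → DistAtLeast Γ u v (suc (col u))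
    packing (I , x) (J , y) u≢v eq m m<c w with <-cmp (toℕ I) (toℕ J)
    ... | tri< I<J _ _ = across I<J eq (s≤s⁻¹ m<c) w
    ... | tri≈ _ I≡J _ = same-copy I≡J u≢v eq (s≤s⁻¹ m<c) w
    ... | tri> _ _ J<I = across J<I (sym eq) (subst (m ≤_) eq (s≤s⁻¹ m<c)) (reverse Γ-undirected w)

-- Read around C_{4s+1} from vertex 0, colourA x is  1 2 x 1 3 1 2 (1 3 1 2)^(s-2) 1 3
-- and colourB is  1 2 1 3 4 1 2 (1 3 1 2)^(s-2) 1 3.
colourA : ℕ → State → ℕ
colourA x L0 = 1
colourA x L1 = 2
colourA x L2 = x
colourA x L3 = 1
colourA x L4 = 3
colourA x L5 = 1
colourA x L6 = 2
colourA x M0 = 3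
colourA x M1 = 1
colourA x M2 = 2
colourA x M3 = 1

colourB : State → ℕ
colourB L0 = 1
colourB L1 = 2
colourB L2 = 1
colourB L3 = 3
colourB L4 = 4
colourB L5 = 1
colourB L6 = 2
colourB M0 = 3
colourB M1 = 1
colourB M2 = 2
colourB M3 = 1

alternating : ℕ → State → ℕ
alternating 0             = colourA 4
alternating 1             = colourA 5
alternating (suc (suc i)) = alternating i

alternating-scheme : ∀ t → Scheme t 5
alternating-scheme t = record
  { colour = alternating ; in-range = range ; self-packing = self
  ; compatible = λ i d _ → compat i d }
  where
  range : ∀ i → InRange 5 (alternating i)
  range 0             = from-yes (in-range? 5 (colourA 4))
  range 1             = from-yes (in-range? 5 (colourA 5))
  range (suc (suc i)) = range i

  self : ∀ i → SelfPacking (alternating i)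
  self 0             = from-yes (self-packing? (colourA 4))
  self 1             = from-yes (self-packing? (colourA 5))
  self (suc (suc i)) = self i

  compat : ∀ i d → Compatible d (alternating i) (alternating (suc (i + d)))
  compat i (suc (suc d)) = compatible-far d (λ σ → m≤n⇒m≤1+n (proj₂ (range i σ)))
  compat 0 0             = from-yes (compatible? 0 (colourA 4) (colourA 5))
  compat 0 1             = from-yes (compatible? 1 (colourA 4) (colourA 4))
  compat 1 0             = from-yes (compatible? 0 (colourA 5) (colourA 4))
  compat 1 1             = from-yes (compatible? 1 (colourA 5) (colourA 5))
  compat (suc (suc i)) 0 = compat i 0
  compat (suc (suc i)) 1 = compat i 1

two-copies : ℕ → State → ℕ
two-copies 0       = colourA 4
two-copies (suc _) = colourB

two-copies-scheme : ∀ t → t ≤ 2 → Scheme t 4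
two-copies-scheme t t≤2 = record
  { colour = two-copies ; in-range = range ; self-packing = self
  ; compatible = λ i d i+d<t → compat i d (≤-trans i+d<t t≤2) }
  where
  range : ∀ i → InRange 4 (two-copies i)
  range 0       = from-yes (in-range? 4 (colourA 4))
  range (suc _) = from-yes (in-range? 4 colourB)

  self : ∀ i → SelfPacking (two-copies i)
  self 0       = from-yes (self-packing? (colourA 4))
  self (suc _) = from-yes (self-packing? colourB)

  compat : ∀ i d → suc (i + d) < 2 → Compatible d (two-copies i) (two-copies (suc (i + d)))
  compat 0       0       _ = from-yes (compatible? 0 (colourA 4) colourB)
  compat 0       (suc d) (s≤s (s≤s ()))
  compat (suc i) d       (s≤s (s≤s ()))

no-packing-below-4 : ∀ t′ s′ j → j < 4 → ¬ PackingColoring (P◇C (suc t′) (suc s′)) j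
no-packing-below-4 t′ s′ j j<4 =
  odd-cycle-no-packing-3 (4 * suc s′) 3≤4s 2∣4s
  ∘ packing-restrict (zero ,_) (cong proj₂) (λ a → inj₁ (refl , a))
  ∘ packing-mono (s≤s⁻¹ j<4)
  where
  3≤4s : 3 ≤ 4 * suc s′
  3≤4s = ≤-trans (n≤1+n 3) (m≤m*n 4 (suc s′))
  2∣4s : 2 ∣ 4 * suc s′
  2∣4s = ∣-trans (divides 2 refl) (m∣m*n (suc s′))

theorem6 : (t s : ℕ) → 1 ≤ t → 2 ≤ s →
    (t ≤ 2 → χp≤ (P◇C t s) 4)
    × (3 ≤ t → χp≤ (P◇C t s) 5)
    × (t ≤ 2 → χp≡ (P◇C t s) 4)
theorem6 t@(suc t′) (suc (suc s′)) _ _ =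
    four-colouring
  , (λ _ → scheme-packing (alternating-scheme t))
  , (λ t≤2 → four-colouring t≤2 , no-packing-below-4 t′ (suc s′))
  where
  open Product t s′
  four-colouring : t ≤ 2 → PackingColoring Γ 4
  four-colouring t≤2 = scheme-packing (two-copies-scheme t t≤2)
theorem6 zero          _             ()  _
theorem6 (suc _)       zero          _   ()
theorem6 (suc _)       (suc zero)    _   (s≤s ())
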